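{- Let $T$ be a rooted tree with distinguishable nodes and let $b:T\to\mathbb{N}_{\ge1}$ be a function with $\sum_{v\in T}b(v)=m$. Then the number $|\mathcal{L}(T)|$ of increasing multilabellings of $T$ with label set $\{1,\dots,m\}$ in which each node $v$ receives exactly $b(v)$ labels is \[|\mathcal{L}(T)|=\frac{m!}{\prod_{v\in T}\big(h^{[b]}(v)\big)^{\underline{b(v)}}}.\]
   Context: An increasing multilabelling of $T$ with label set $\{1,\dots,m\}$ assigns to each node a set of labels, these sets partitioning $\{1,\dots,m\}$, such that every label of a child is larger than every label of its parent. The bucket hook-length is $h^{[b]}(v)=\sum_{u}b(u)$, the sum over all descendants $u$ of $v$ including $v$ itself. $x^{\underline{s}}=x(x-1)\cdots(x-s+1)$ is the falling factorial. -}

module Defs where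

open import Data.Nat using (ℕ; zero; suc; _+_; _*_; _∸_)
open import Data.Fin using (Fin; _<_)
open import Data.List using (List; []; _∷_; _++_; map; filter; length; allFin)
open import Data.Nat.ListAction using (sum)
open import Data.Vec using (Vec; lookup)
open import Relation.Binary.PropositionalEquality using (_≡_; refl; cong)
open import Relation.Nullary using (Dec; yes; no; ¬_)
open import Data.Product using (_×_)

-- Rooted (plane) trees; nodes are distinguished by their position.
data Tree : Set where
  node : List Tree → Tree

data Pos : Tree → Set
data PosL : List Tree → Set

data Pos where
  root  : ∀ {ts} → Pos (node ts)
  below : ∀ {ts} → PosL ts → Pos (node ts)

data PosL where
  hd : ∀ {t ts} → Pos t → PosL (t ∷ ts)
  tl : ∀ {t ts} → PosL ts → PosL (t ∷ ts)

allPos  : (t : Tree) → List (Pos t)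
allPosL : (ts : List Tree) → List (PosL ts)
allPos (node ts) = root ∷ map below (allPosL ts)
allPosL [] = []
allPosL (t ∷ ts) = map hd (allPos t) ++ map tl (allPosL ts)

hd-inj : ∀ {t ts} {p q : Pos t} → hd {t} {ts} p ≡ hd q → p ≡ q
hd-inj refl = refl
tl-inj : ∀ {t ts} {p q : PosL ts} → tl {t} {ts} p ≡ tl q → p ≡ q
tl-inj refl = refl
below-inj : ∀ {ts} {p q : PosL ts} → below p ≡ below q → p ≡ q
below-inj refl = refl

_≟P_  : ∀ {t} (p q : Pos t) → Dec (p ≡ q)
_≟PL_ : ∀ {ts} (p q : PosL ts) → Dec (p ≡ q)
root ≟P root = yes refl
root ≟P below _ = no (λ ())
below _ ≟P root = no (λ ())
below p ≟P below q with p ≟PL q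
... | yes e = yes (cong below e)
... | no ne = no (λ e → ne (below-inj e))
hd p ≟PL hd q with p ≟P q
... | yes e = yes (cong hd e)
... | no ne = no (λ e → ne (hd-inj e))
hd _ ≟PL tl _ = no (λ ())
tl _ ≟PL hd _ = no (λ ())
tl p ≟PL tl q with p ≟PL q
... | yes e = yes (cong tl e)
... | no ne = no (λ e → ne (tl-inj e))

-- parent relation:  Par u v  means  v is a child of u
data IsTopL : ∀ {ts} → PosL ts → Set where
  top-hd : ∀ {ts} {t : List Tree} → IsTopL (hd {node t} {ts} root)
  top-tl : ∀ {t ts} {p : PosL ts} → IsTopL p → IsTopL (tl {t} p)

data Par  : ∀ {t} → Pos t → Pos t → Set
data ParL : ∀ {ts} → PosL ts → PosL ts → Set
data Par where
  par-root  : ∀ {ts} {p : PosL ts} → IsTopL p → Par root (below p)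
  par-below : ∀ {ts} {p q : PosL ts} → ParL p q → Par (below p) (below q)
data ParL where
  parL-hd : ∀ {t ts} {p q : Pos t} → Par p q → ParL (hd {t} {ts} p) (hd q)
  parL-tl : ∀ {t ts} {p q : PosL ts} → ParL p q → ParL (tl {t} p) (tl q)

sub  : ∀ {t} → Pos t → Tree
subL : ∀ {ts} → PosL ts → Tree
sub (root {ts}) = node ts
sub (below p) = subL p
subL (hd p) = sub p
subL (tl p) = subL p

emb  : ∀ {t} (p : Pos t) → Pos (sub p) → Pos t
embL : ∀ {ts} (p : PosL ts) → Pos (subL p) → PosL ts
emb root u = u
emb (below p) u = below (embL p u)
embL (hd p) u = hd (emb p u)
embL (tl p) u = tl (embL p u)

hook : ∀ {t} → (Pos t → ℕ) → Pos t → ℕ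
hook b v = sum (map (λ u → b (emb v u)) (allPos (sub v)))

_↓_ : ℕ → ℕ → ℕ
x ↓ zero = 1
x ↓ suc s = x * ((x ∸ 1) ↓ s)

-- A multilabelling with labels {1..m} is encoded by  lab : Vec (Pos t) m,
-- label i+1 (i : Fin m) being given to node  lookup lab i.
-- (Hence the label sets of the nodes automatically partition {1..m}.)
labelsAt : ∀ {t m} → Vec (Pos t) m → Pos t → ℕ
labelsAt {m = m} lab v = length (filter (λ i → lookup lab i ≟P v) (allFin m))

IsIncMultilabelling : ∀ {t m} → (Pos t → ℕ) → Vec (Pos t) m → Set
IsIncMultilabelling {t} {m} b lab =
  (∀ (v : Pos t) → labelsAt lab v ≡ b v) ×
  (∀ (i j : Fin m) → Par (lookup lab i) (lookup lab j) → i < j)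

-- Count the labellings by the node receiving the smallest label. That node must be
-- available: it still needs a label while none of its ancestors does. Removing the
-- label lowers its weight by one, and the rest is again increasing along ancestors
-- (nodes of weight 0 being harmless for that relation). Lowering the weight of an
-- available node v divides ∏ h↓b by h(v), since only the hooks of v and of its
-- weightless ancestors change; and the subtrees of the available nodes carry all the
-- weight, so Σ_{v available} h(v) = m. With N(b) the number of labellings, induction
-- on m gives N(b) · ∏ h↓b = Σ_{v available} h(v) · (m − 1)! = m!.
module Submission where

open import Defs
open import Data.Bool using (Bool; true; false; not; _∧_; if_then_else_)
open import Data.Empty using (⊥-elim)
open import Data.Fin using (Fin; _<_) renaming (zero to fzero; suc to fsuc)
import Data.Fin.Properties as Fin
open import Data.List using (List; []; _∷_; _++_; map; length; filter; tabulate; allFin)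
open import Data.List.Membership.Propositional using (_∈_)
open import Data.List.Membership.Propositional.Properties using (∈-map⁺; ∈-map⁻; ∈-++⁺ˡ; ∈-++⁺ʳ; ∈-++⁻)
open import Data.List.Properties using (map-++; map-∘; map-cong; length-++; length-map)
open import Data.List.Relation.Unary.All as All using (All; []; _∷_)
open import Data.List.Relation.Unary.AllPairs using ([]; _∷_)
open import Data.List.Relation.Unary.Any using (here; there)
open import Data.List.Relation.Unary.Unique.Propositional using (Unique)
open import Data.List.Relation.Unary.Unique.Propositional.Properties using (map⁺; ++⁺)
open import Data.Nat using (ℕ; zero; suc; _+_; _*_; _∸_; _≤_; _!; _≡ᵇ_; z≤n; s≤s; s<s⁻¹)
open import Data.Nat.ListAction using (sum; product)
open import Data.Nat.ListAction.Properties using (sum-++; product-++)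
open import Data.Nat.Properties
open import Algebra.Properties.CommutativeSemigroup *-commutativeSemigroup using (x∙yz≈y∙xz)
open import Data.Product using (Σ; _×_; _,_; proj₁; proj₂)
open import Data.Sum using (inj₁; inj₂)
open import Data.Vec using (Vec; lookup) renaming ([] to []ᵥ; _∷_ to _∷ᵥ_)
open import Data.Vec.Properties using (∷-injectiveʳ)
open import Function using (_∘_)
open import Function.Bundles using (_⇔_; mk⇔)
open import Relation.Binary.Construct.Closure.Transitive using (Plus; [_]; _∼⁺⟨_⟩_) renaming (map to Plus-map)
open import Relation.Binary.PropositionalEquality
open import Relation.Nullary using (¬_; Dec; yes; no; does)

sumPos : ∀ {t} → (Pos t → ℕ) → ℕ
sumPos {t} f = sum (map f (allPos t))

sumPosL : ∀ {ts} → (PosL ts → ℕ) → ℕ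
sumPosL {ts} f = sum (map f (allPosL ts))

prodPos : ∀ {t} → (Pos t → ℕ) → ℕ
prodPos {t} f = product (map f (allPos t))

prodPosL : ∀ {ts} → (PosL ts → ℕ) → ℕ
prodPosL {ts} f = product (map f (allPosL ts))

map-allPos-node : ∀ {A : Set} {ts} (f : Pos (node ts) → A) →
  map f (allPos (node ts)) ≡ f root ∷ map (f ∘ below) (allPosL ts)
map-allPos-node {ts = ts} f = cong (f root ∷_) (sym (map-∘ (allPosL ts)))

map-allPosL-∷ : ∀ {A : Set} {t ts} (f : PosL (t ∷ ts) → A) →
  map f (allPosL (t ∷ ts)) ≡ map (f ∘ hd) (allPos t) ++ map (f ∘ tl) (allPosL ts)
map-allPosL-∷ {t = t} {ts} f = begin
  map f (map hd (allPos t) ++ map tl (allPosL ts))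
    ≡⟨ map-++ f (map hd (allPos t)) (map tl (allPosL ts)) ⟩
  map f (map hd (allPos t)) ++ map f (map tl (allPosL ts))
    ≡⟨ cong₂ _++_ (sym (map-∘ (allPos t))) (sym (map-∘ (allPosL ts))) ⟩
  map (f ∘ hd) (allPos t) ++ map (f ∘ tl) (allPosL ts) ∎
  where open ≡-Reasoning

sumPos-node : ∀ {ts} (f : Pos (node ts) → ℕ) → sumPos f ≡ f root + sumPosL (f ∘ below)
sumPos-node f = cong sum (map-allPos-node f)

prodPos-node : ∀ {ts} (f : Pos (node ts) → ℕ) → prodPos f ≡ f root * prodPosL (f ∘ below)
prodPos-node f = cong product (map-allPos-node f)

sumPosL-∷ : ∀ {t ts} (f : PosL (t ∷ ts) → ℕ) → sumPosL f ≡ sumPos (f ∘ hd) + sumPosL (f ∘ tl)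
sumPosL-∷ {t} {ts} f = trans (cong sum (map-allPosL-∷ f)) (sum-++ (map (f ∘ hd) (allPos t)) _)

prodPosL-∷ : ∀ {t ts} (f : PosL (t ∷ ts) → ℕ) → prodPosL f ≡ prodPos (f ∘ hd) * prodPosL (f ∘ tl)
prodPosL-∷ {t} {ts} f = trans (cong product (map-allPosL-∷ f)) (product-++ (map (f ∘ hd) (allPos t)) _)

sumPosL-cong : ∀ {ts} {f g : PosL ts → ℕ} → (∀ x → f x ≡ g x) → sumPosL f ≡ sumPosL g
sumPosL-cong {ts} e = cong sum (map-cong e (allPosL ts))

sum-map-zero : ∀ {A : Set} (xs : List A) → sum (map (λ _ → 0) xs) ≡ 0
sum-map-zero [] = refl
sum-map-zero (x ∷ xs) = sum-map-zero xs

hookL : ∀ {ts} → (PosL ts → ℕ) → PosL ts → ℕ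
hookL b v = sum (map (λ u → b (embL v u)) (allPos (subL v)))

available  : ∀ {t} → (Pos t → ℕ) → Pos t → Bool
availableL : ∀ {ts} → (PosL ts → ℕ) → PosL ts → Bool
available b root = not (b root ≡ᵇ 0)
available b (below p) = (b root ≡ᵇ 0) ∧ availableL (b ∘ below) p
availableL b (hd p) = available (b ∘ hd) p
availableL b (tl p) = availableL (b ∘ tl) p

available-root⁻ : ∀ {ts} (b : Pos (node ts) → ℕ) → available b root ≡ true → 1 ≤ b root
available-root⁻ b = positive (b root)
  where
  positive : ∀ n → not (n ≡ᵇ 0) ≡ true → 1 ≤ n
  positive (suc n) _ = s≤s z≤n

available-below⁻ : ∀ {ts} (b : Pos (node ts) → ℕ) p → available b (below p) ≡ true →
  b root ≡ 0 × availableL (b ∘ below) p ≡ true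
available-below⁻ b p = zero∧ (b root)
  where
  zero∧ : ∀ n {x} → (n ≡ᵇ 0) ∧ x ≡ true → n ≡ 0 × x ≡ true
  zero∧ zero e = refl , e

available⇒positive  : ∀ {t} (b : Pos t → ℕ) v → available b v ≡ true → 1 ≤ b v
availableL⇒positive : ∀ {ts} (b : PosL ts → ℕ) v → availableL b v ≡ true → 1 ≤ b v
available⇒positive b root av = available-root⁻ b av
available⇒positive b (below p) av = availableL⇒positive (b ∘ below) p (proj₂ (available-below⁻ b p av))
availableL⇒positive b (hd p) av = available⇒positive (b ∘ hd) p av
availableL⇒positive b (tl p) av = availableL⇒positive (b ∘ tl) p av

availableHook : ∀ {t} → (Pos t → ℕ) → Pos t → ℕ
availableHook b v = if available b v then hook b v else 0

availableHookL : ∀ {ts} → (PosL ts → ℕ) → PosL ts → ℕ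
availableHookL b v = if availableL b v then hookL b v else 0

sumPos-availableHook   : ∀ {t} (b : Pos t → ℕ) → sumPos (availableHook b) ≡ sumPos b
sumPosL-availableHookL : ∀ {ts} (b : PosL ts → ℕ) → sumPosL (availableHookL b) ≡ sumPosL b
sumPos-availableHook {node ts} b = byRootWeight (b root) refl
  where
  open ≡-Reasoning
  atRoot : ∀ {n} → b root ≡ n → availableHook b root ≡ (if not (n ≡ᵇ 0) then sumPos b else 0)
  atRoot = cong (λ n → if not (n ≡ᵇ 0) then sumPos b else 0)
  atBelow : ∀ {n} → b root ≡ n → ∀ p →
    availableHook b (below p) ≡ (if (n ≡ᵇ 0) ∧ availableL (b ∘ below) p then hookL (b ∘ below) p else 0)
  atBelow b₀≡n p = cong (λ n → if (n ≡ᵇ 0) ∧ availableL (b ∘ below) p then hookL (b ∘ below) p else 0) b₀≡n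
  byRootWeight : ∀ n → b root ≡ n → sumPos (availableHook b) ≡ sumPos b
  byRootWeight zero b₀≡0 = begin
    sumPos (availableHook b)                                 ≡⟨ sumPos-node (availableHook b) ⟩
    availableHook b root + sumPosL (availableHook b ∘ below) ≡⟨ cong₂ _+_ (atRoot b₀≡0) (sumPosL-cong (atBelow b₀≡0)) ⟩
    sumPosL (availableHookL (b ∘ below))                     ≡⟨ sumPosL-availableHookL (b ∘ below) ⟩
    sumPosL (b ∘ below)                                      ≡⟨ cong (_+ sumPosL (b ∘ below)) (sym b₀≡0) ⟩
    b root + sumPosL (b ∘ below)                             ≡⟨ sym (sumPos-node b) ⟩
    sumPos b                                                 ∎
  byRootWeight (suc _) b₀≡1+n = begin
    sumPos (availableHook b)                                 ≡⟨ sumPos-node (availableHook b) ⟩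
    availableHook b root + sumPosL (availableHook b ∘ below) ≡⟨ cong₂ _+_ (atRoot b₀≡1+n) (sumPosL-cong (atBelow b₀≡1+n)) ⟩
    sumPos b + sumPosL {ts} (λ _ → 0)                        ≡⟨ cong (sumPos b +_) (sum-map-zero (allPosL ts)) ⟩
    sumPos b + 0                                             ≡⟨ +-identityʳ (sumPos b) ⟩
    sumPos b                                                 ∎
sumPosL-availableHookL {[]} b = refl
sumPosL-availableHookL {t ∷ ts} b = begin
  sumPosL (availableHookL b)                                     ≡⟨ sumPosL-∷ (availableHookL b) ⟩
  sumPos (availableHook (b ∘ hd)) + sumPosL (availableHookL (b ∘ tl))
    ≡⟨ cong₂ _+_ (sumPos-availableHook (b ∘ hd)) (sumPosL-availableHookL (b ∘ tl)) ⟩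
  sumPos (b ∘ hd) + sumPosL (b ∘ tl)                             ≡⟨ sym (sumPosL-∷ b) ⟩
  sumPosL b                                                      ∎
  where open ≡-Reasoning

-- Structural rather than a test u ≟P v, so that decAt commutes definitionally with
-- splitting a tree into its root and subtrees.
decAt  : ∀ {t} → (Pos t → ℕ) → Pos t → Pos t → ℕ
decAtL : ∀ {ts} → (PosL ts → ℕ) → PosL ts → PosL ts → ℕ
decAt b root root = b root ∸ 1
decAt b root (below q) = b (below q)
decAt b (below p) root = b root
decAt b (below p) (below q) = decAtL (b ∘ below) p q
decAtL b (hd p) (hd q) = decAt (b ∘ hd) p q
decAtL b (hd p) (tl q) = b (tl q)
decAtL b (tl p) (hd q) = b (hd q)
decAtL b (tl p) (tl q) = decAtL (b ∘ tl) p q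

decAt-self  : ∀ {t} (b : Pos t → ℕ) v → decAt b v v ≡ b v ∸ 1
decAtL-self : ∀ {ts} (b : PosL ts → ℕ) v → decAtL b v v ≡ b v ∸ 1
decAt-self b root = refl
decAt-self b (below p) = decAtL-self (b ∘ below) p
decAtL-self b (hd p) = decAt-self (b ∘ hd) p
decAtL-self b (tl p) = decAtL-self (b ∘ tl) p

decAt-other  : ∀ {t} (b : Pos t → ℕ) v u → u ≢ v → decAt b v u ≡ b u
decAtL-other : ∀ {ts} (b : PosL ts → ℕ) v u → u ≢ v → decAtL b v u ≡ b u
decAt-other b root root u≢v = ⊥-elim (u≢v refl)
decAt-other b root (below q) _ = refl
decAt-other b (below p) root _ = refl
decAt-other b (below p) (below q) u≢v = decAtL-other (b ∘ below) p q (u≢v ∘ cong below)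
decAtL-other b (hd p) (hd q) u≢v = decAt-other (b ∘ hd) p q (u≢v ∘ cong hd)
decAtL-other b (hd p) (tl q) _ = refl
decAtL-other b (tl p) (hd q) _ = refl
decAtL-other b (tl p) (tl q) u≢v = decAtL-other (b ∘ tl) p q (u≢v ∘ cong tl)

decAt-≤ : ∀ {t} (b : Pos t → ℕ) v u → decAt b v u ≤ b u
decAt-≤ b v u with u ≟P v
... | yes refl = subst (_≤ b u) (sym (decAt-self b u)) (m∸n≤m (b u) 1)
... | no u≢v = ≤-reflexive (decAt-other b v u u≢v)

suc-∸1 : ∀ {n} → 1 ≤ n → suc (n ∸ 1) ≡ n
suc-∸1 (s≤s _) = refl

sumPos-decAt  : ∀ {t} (b : Pos t → ℕ) v → 1 ≤ b v → sumPos b ≡ suc (sumPos (decAt b v))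
sumPosL-decAtL : ∀ {ts} (b : PosL ts → ℕ) v → 1 ≤ b v → sumPosL b ≡ suc (sumPosL (decAtL b v))
sumPos-decAt {node ts} b root 1≤b = begin
  sumPos b                               ≡⟨ sumPos-node b ⟩
  b root + sumPosL (b ∘ below)           ≡⟨ cong (_+ sumPosL (b ∘ below)) (sym (suc-∸1 1≤b)) ⟩
  suc (b root ∸ 1 + sumPosL (b ∘ below)) ≡⟨ cong suc (sym (sumPos-node (decAt b root))) ⟩
  suc (sumPos (decAt b root))            ∎
  where open ≡-Reasoning
sumPos-decAt {node ts} b (below p) 1≤b = begin
  sumPos b                                        ≡⟨ sumPos-node b ⟩
  b root + sumPosL (b ∘ below)                    ≡⟨ cong (b root +_) (sumPosL-decAtL (b ∘ below) p 1≤b) ⟩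
  b root + suc (sumPosL (decAtL (b ∘ below) p))   ≡⟨ +-suc (b root) _ ⟩
  suc (b root + sumPosL (decAtL (b ∘ below) p))   ≡⟨ cong suc (sym (sumPos-node (decAt b (below p)))) ⟩
  suc (sumPos (decAt b (below p)))                ∎
  where open ≡-Reasoning
sumPosL-decAtL {t ∷ ts} b (hd p) 1≤b = begin
  sumPosL b                                       ≡⟨ sumPosL-∷ b ⟩
  sumPos (b ∘ hd) + sumPosL (b ∘ tl)              ≡⟨ cong (_+ sumPosL (b ∘ tl)) (sumPos-decAt (b ∘ hd) p 1≤b) ⟩
  suc (sumPos (decAt (b ∘ hd) p) + sumPosL (b ∘ tl)) ≡⟨ cong suc (sym (sumPosL-∷ (decAtL b (hd p)))) ⟩
  suc (sumPosL (decAtL b (hd p)))                 ∎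
  where open ≡-Reasoning
sumPosL-decAtL {t ∷ ts} b (tl p) 1≤b = begin
  sumPosL b                                       ≡⟨ sumPosL-∷ b ⟩
  sumPos (b ∘ hd) + sumPosL (b ∘ tl)              ≡⟨ cong (sumPos (b ∘ hd) +_) (sumPosL-decAtL (b ∘ tl) p 1≤b) ⟩
  sumPos (b ∘ hd) + suc (sumPosL (decAtL (b ∘ tl) p)) ≡⟨ +-suc (sumPos (b ∘ hd)) _ ⟩
  suc (sumPos (b ∘ hd) + sumPosL (decAtL (b ∘ tl) p)) ≡⟨ cong suc (sym (sumPosL-∷ (decAtL b (tl p)))) ⟩
  suc (sumPosL (decAtL b (tl p)))                 ∎
  where open ≡-Reasoning

fallingHook : ∀ {t} → (Pos t → ℕ) → Pos t → ℕ
fallingHook b v = hook b v ↓ b v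

fallingHookL : ∀ {ts} → (PosL ts → ℕ) → PosL ts → ℕ
fallingHookL b v = hookL b v ↓ b v

↓-unfold : ∀ x {n} → 1 ≤ n → x ↓ n ≡ x * ((x ∸ 1) ↓ (n ∸ 1))
↓-unfold x (s≤s _) = refl

prodPos-fallingHook-weightless-root : ∀ {ts} (b : Pos (node ts) → ℕ) → b root ≡ 0 →
  prodPos (fallingHook b) ≡ prodPosL (fallingHookL (b ∘ below))
prodPos-fallingHook-weightless-root b b₀≡0 = begin
  prodPos (fallingHook b)                                       ≡⟨ prodPos-node (fallingHook b) ⟩
  (hook b root ↓ b root) * prodPosL (fallingHookL (b ∘ below))
    ≡⟨ cong (λ n → (hook b root ↓ n) * prodPosL (fallingHookL (b ∘ below))) b₀≡0 ⟩
  1 * prodPosL (fallingHookL (b ∘ below))                       ≡⟨ *-identityˡ _ ⟩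
  prodPosL (fallingHookL (b ∘ below))                           ∎
  where open ≡-Reasoning

prodPos-decAt  : ∀ {t} (b : Pos t → ℕ) v → available b v ≡ true →
  prodPos (fallingHook b) ≡ hook b v * prodPos (fallingHook (decAt b v))
prodPosL-decAtL : ∀ {ts} (b : PosL ts → ℕ) v → availableL b v ≡ true →
  prodPosL (fallingHookL b) ≡ hookL b v * prodPosL (fallingHookL (decAtL b v))
prodPos-decAt {node ts} b root av = begin
  prodPos (fallingHook b)                              ≡⟨ prodPos-node (fallingHook b) ⟩
  (h ↓ b root) * rest                                  ≡⟨ cong (_* rest) (↓-unfold h (available-root⁻ b av)) ⟩
  h * ((h ∸ 1) ↓ (b root ∸ 1)) * rest                  ≡⟨ *-assoc h _ rest ⟩
  h * (((h ∸ 1) ↓ (b root ∸ 1)) * rest)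
    ≡⟨ cong (λ x → h * ((x ↓ (b root ∸ 1)) * rest)) hook-decAt ⟩
  h * ((hook (decAt b root) root ↓ (b root ∸ 1)) * rest) ≡⟨ cong (h *_) (sym (prodPos-node (fallingHook (decAt b root)))) ⟩
  h * prodPos (fallingHook (decAt b root))             ∎
  where
    open ≡-Reasoning
    h = hook b root
    rest = prodPosL (fallingHook b ∘ below)
    hook-decAt : h ∸ 1 ≡ hook (decAt b root) root
    hook-decAt = cong (_∸ 1) (sumPos-decAt b root (available-root⁻ b av))
prodPos-decAt {node ts} b (below p) av = begin
  prodPos (fallingHook b)                                       ≡⟨ prodPos-fallingHook-weightless-root b b₀≡0 ⟩
  prodPosL (fallingHookL (b ∘ below))                           ≡⟨ prodPosL-decAtL (b ∘ below) p avp ⟩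
  hookL (b ∘ below) p * prodPosL (fallingHookL (decAtL (b ∘ below) p))
    ≡⟨ cong (hookL (b ∘ below) p *_) (sym (prodPos-fallingHook-weightless-root (decAt b (below p)) b₀≡0)) ⟩
  hook b (below p) * prodPos (fallingHook (decAt b (below p)))  ∎
  where
    open ≡-Reasoning
    b₀≡0 = proj₁ (available-below⁻ b p av)
    avp = proj₂ (available-below⁻ b p av)
prodPosL-decAtL {t ∷ ts} b (hd p) av = begin
  prodPosL (fallingHookL b)                           ≡⟨ prodPosL-∷ (fallingHookL b) ⟩
  prodPos (fallingHook (b ∘ hd)) * rest               ≡⟨ cong (_* rest) (prodPos-decAt (b ∘ hd) p av) ⟩
  h * prodPos (fallingHook (decAt (b ∘ hd) p)) * rest ≡⟨ *-assoc h _ rest ⟩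
  h * (prodPos (fallingHook (decAt (b ∘ hd) p)) * rest) ≡⟨ cong (h *_) (sym (prodPosL-∷ (fallingHookL (decAtL b (hd p))))) ⟩
  h * prodPosL (fallingHookL (decAtL b (hd p)))       ∎
  where
    open ≡-Reasoning
    h = hookL b (hd p)
    rest = prodPosL (fallingHookL (b ∘ tl))
prodPosL-decAtL {t ∷ ts} b (tl p) av = begin
  prodPosL (fallingHookL b)                          ≡⟨ prodPosL-∷ (fallingHookL b) ⟩
  first * prodPosL (fallingHookL (b ∘ tl))           ≡⟨ cong (first *_) (prodPosL-decAtL (b ∘ tl) p av) ⟩
  first * (h * rest)                                 ≡⟨ x∙yz≈y∙xz first h rest ⟩
  h * (first * rest)                                 ≡⟨ cong (h *_) (sym (prodPosL-∷ (fallingHookL (decAtL b (tl p))))) ⟩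
  h * prodPosL (fallingHookL (decAtL b (tl p)))      ∎
  where
    open ≡-Reasoning
    first = prodPos (fallingHook (b ∘ hd))
    h = hookL b (tl p)
    rest = prodPosL (fallingHookL (decAtL (b ∘ tl) p))

data Ancestor  : ∀ {t} → Pos t → Pos t → Set
data AncestorL : ∀ {ts} → PosL ts → PosL ts → Set
data Ancestor where
  root-anc  : ∀ {ts} {p : PosL ts} → Ancestor root (below p)
  below-anc : ∀ {ts} {p q : PosL ts} → AncestorL p q → Ancestor (below p) (below q)
data AncestorL where
  hd-anc : ∀ {t ts} {p q : Pos t} → Ancestor p q → AncestorL (hd {t} {ts} p) (hd q)
  tl-anc : ∀ {t ts} {p q : PosL ts} → AncestorL p q → AncestorL (tl {t} p) (tl q)

Ancestor-irrefl  : ∀ {t} {v : Pos t} → ¬ Ancestor v v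
AncestorL-irrefl : ∀ {ts} {v : PosL ts} → ¬ AncestorL v v
Ancestor-irrefl (below-anc a) = AncestorL-irrefl a
AncestorL-irrefl (hd-anc a) = Ancestor-irrefl a
AncestorL-irrefl (tl-anc a) = AncestorL-irrefl a

Par⇒Ancestor   : ∀ {t} {u v : Pos t} → Par u v → Ancestor u v
ParL⇒AncestorL : ∀ {ts} {u v : PosL ts} → ParL u v → AncestorL u v
Par⇒Ancestor (par-root _) = root-anc
Par⇒Ancestor (par-below p) = below-anc (ParL⇒AncestorL p)
ParL⇒AncestorL (parL-hd p) = hd-anc (Par⇒Ancestor p)
ParL⇒AncestorL (parL-tl p) = tl-anc (ParL⇒AncestorL p)

root-Par⁺ : ∀ {ts} (p : PosL ts) → Plus Par (root {ts}) (below p)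
root-Par⁺ {node _ ∷ _} (hd root) = [ par-root top-hd ]
root-Par⁺ {node _ ∷ _} (hd (below r)) =
  _ ∼⁺⟨ [ par-root top-hd ] ⟩ Plus-map (par-below ∘ parL-hd) (root-Par⁺ r)
root-Par⁺ {t ∷ _} (tl p) = Plus-map {f = shift} shift-Par (root-Par⁺ p)
  where
  shift : ∀ {ts} → Pos (node ts) → Pos (node (t ∷ ts))
  shift root = root
  shift (below q) = below (tl q)
  shift-Par : ∀ {ts} {x y : Pos (node ts)} → Par x y → Par (shift x) (shift y)
  shift-Par (par-root top) = par-root (top-tl top)
  shift-Par (par-below e) = par-below (parL-tl e)

Ancestor⇒Par⁺   : ∀ {t} {u v : Pos t} → Ancestor u v → Plus Par u v
AncestorL⇒ParL⁺ : ∀ {ts} {u v : PosL ts} → AncestorL u v → Plus ParL u v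
Ancestor⇒Par⁺ (root-anc {p = p}) = root-Par⁺ p
Ancestor⇒Par⁺ (below-anc a) = Plus-map par-below (AncestorL⇒ParL⁺ a)
AncestorL⇒ParL⁺ (hd-anc a) = Plus-map parL-hd (Ancestor⇒Par⁺ a)
AncestorL⇒ParL⁺ (tl-anc a) = Plus-map parL-tl (AncestorL⇒ParL⁺ a)

available⇒ancestor-weightless  : ∀ {t} (b : Pos t → ℕ) {u v} → available b v ≡ true → Ancestor u v → b u ≡ 0
availableL⇒ancestor-weightless : ∀ {ts} (b : PosL ts → ℕ) {u v} → availableL b v ≡ true → AncestorL u v → b u ≡ 0
available⇒ancestor-weightless b {v = below p} av root-anc = proj₁ (available-below⁻ b p av)
available⇒ancestor-weightless b {v = below p} av (below-anc a) =
  availableL⇒ancestor-weightless (b ∘ below) (proj₂ (available-below⁻ b p av)) a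
availableL⇒ancestor-weightless b av (hd-anc a) = available⇒ancestor-weightless (b ∘ hd) av a
availableL⇒ancestor-weightless b av (tl-anc a) = availableL⇒ancestor-weightless (b ∘ tl) av a

available⁺  : ∀ {t} (b : Pos t → ℕ) v → 1 ≤ b v → (∀ u → Ancestor u v → b u ≡ 0) → available b v ≡ true
availableL⁺ : ∀ {ts} (b : PosL ts → ℕ) v → 1 ≤ b v → (∀ u → AncestorL u v → b u ≡ 0) → availableL b v ≡ true
available⁺ b root 1≤b _ with b root
... | suc _ = refl
available⁺ b (below p) 1≤b above≡0 =
  trans (cong (λ n → (n ≡ᵇ 0) ∧ availableL (b ∘ below) p) (above≡0 root root-anc))
        (availableL⁺ (b ∘ below) p 1≤b (λ u a → above≡0 (below u) (below-anc a)))
availableL⁺ b (hd p) 1≤b above≡0 = available⁺ (b ∘ hd) p 1≤b (λ u a → above≡0 (hd u) (hd-anc a))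
availableL⁺ b (tl p) 1≤b above≡0 = availableL⁺ (b ∘ tl) p 1≤b (λ u a → above≡0 (tl u) (tl-anc a))

length-filter-tabulate : ∀ {A : Set} {P : A → Set} (P? : ∀ x → Dec (P x)) {n} (g : Fin n → A) →
  length (filter P? (tabulate g)) ≡ length (filter (P? ∘ g) (allFin n))
length-filter-tabulate P? {zero} g = refl
length-filter-tabulate P? {suc n} g with does (P? (g fzero))
... | true  = cong suc (trans (length-filter-tabulate P? (g ∘ fsuc)) (sym (length-filter-tabulate (P? ∘ g) fsuc)))
... | false = trans (length-filter-tabulate P? (g ∘ fsuc)) (sym (length-filter-tabulate (P? ∘ g) fsuc))

labelsAt-∷-self : ∀ {t m} (v : Pos t) (lab : Vec (Pos t) m) → labelsAt (v ∷ᵥ lab) v ≡ suc (labelsAt lab v)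
labelsAt-∷-self v lab with v ≟P v
... | yes _  = cong suc (length-filter-tabulate (λ i → lookup (v ∷ᵥ lab) i ≟P v) fsuc)
... | no v≢v = ⊥-elim (v≢v refl)

labelsAt-∷-other : ∀ {t m} (v : Pos t) (lab : Vec (Pos t) m) u → v ≢ u → labelsAt (v ∷ᵥ lab) u ≡ labelsAt lab u
labelsAt-∷-other v lab u v≢u with v ≟P u
... | yes v≡u = ⊥-elim (v≢u v≡u)
... | no _    = length-filter-tabulate (λ i → lookup (v ∷ᵥ lab) i ≟P u) fsuc

labelsAt-lookup : ∀ {t m} (lab : Vec (Pos t) m) i → 1 ≤ labelsAt lab (lookup lab i)
labelsAt-lookup (v ∷ᵥ lab) fzero = subst (1 ≤_) (sym (labelsAt-∷-self v lab)) (s≤s z≤n)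
labelsAt-lookup (v ∷ᵥ lab) (fsuc i) = byCases (v ≟P lookup lab i)
  where
  byCases : Dec (v ≡ lookup lab i) → 1 ≤ labelsAt (v ∷ᵥ lab) (lookup lab i)
  byCases (yes refl) = subst (1 ≤_) (sym (labelsAt-∷-self v lab)) (s≤s z≤n)
  byCases (no v≢u)   = subst (1 ≤_) (sym (labelsAt-∷-other v lab _ v≢u)) (labelsAt-lookup lab i)

labelsAt-positive⇒lookup : ∀ {t m} (lab : Vec (Pos t) m) u → 1 ≤ labelsAt lab u → Σ (Fin m) (λ i → lookup lab i ≡ u)
labelsAt-positive⇒lookup (v ∷ᵥ lab) u 1≤n = byCases (v ≟P u)
  where
  byCases : Dec (v ≡ u) → Σ (Fin _) (λ i → lookup (v ∷ᵥ lab) i ≡ u)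
  byCases (yes v≡u) = fzero , v≡u
  byCases (no v≢u)  =
    let i , e = labelsAt-positive⇒lookup lab u (subst (1 ≤_) (labelsAt-∷-other v lab u v≢u) 1≤n) in fsuc i , e

-- Increasing along ancestors rather than parents: unlike the latter, this survives
-- taking away the smallest label once some node has run out of labels.
IsAncIncMultilabelling : ∀ {t m} → (Pos t → ℕ) → Vec (Pos t) m → Set
IsAncIncMultilabelling {t} {m} b lab =
  (∀ (v : Pos t) → labelsAt lab v ≡ b v) ×
  (∀ (i j : Fin m) → Ancestor (lookup lab i) (lookup lab j) → i < j)

isAncInc-∷⁻ : ∀ {t m} (b : Pos t → ℕ) v (lab : Vec (Pos t) m) → IsAncIncMultilabelling b (v ∷ᵥ lab) →
  available b v ≡ true × IsAncIncMultilabelling (decAt b v) lab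
isAncInc-∷⁻ b v lab (counts , increasing) =
  available⁺ b v 1≤bv ancestors-weightless , counts′ , λ i j a → s<s⁻¹ (increasing (fsuc i) (fsuc j) a)
  where
    count-v : suc (labelsAt lab v) ≡ b v
    count-v = trans (sym (labelsAt-∷-self v lab)) (counts v)
    1≤bv : 1 ≤ b v
    1≤bv = subst (1 ≤_) count-v (s≤s z≤n)
    counts′ : ∀ u → labelsAt lab u ≡ decAt b v u
    counts′ u with u ≟P v
    ... | yes refl = trans (cong (_∸ 1) count-v) (sym (decAt-self b u))
    ... | no u≢v = trans (sym (labelsAt-∷-other v lab u (u≢v ∘ sym))) (trans (counts u) (sym (decAt-other b v u u≢v)))
    -- a labelled ancestor of v would carry a label smaller than the smallest one
    ancestors-weightless : ∀ u → Ancestor u v → b u ≡ 0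
    ancestors-weightless u a with b u in eq
    ... | zero = refl
    ... | suc _ with labelsAt-positive⇒lookup (v ∷ᵥ lab) u (subst (1 ≤_) (sym (trans (counts u) eq)) (s≤s z≤n))
    ...   | i , refl with increasing i fzero a
    ...     | ()

isAncInc-∷⁺ : ∀ {t m} (b : Pos t → ℕ) v (lab : Vec (Pos t) m) →
  available b v ≡ true → IsAncIncMultilabelling (decAt b v) lab → IsAncIncMultilabelling b (v ∷ᵥ lab)
isAncInc-∷⁺ b v lab av (counts , increasing) = (λ u → counts′ u (v ≟P u)) , increasing′
  where
    counts′ : ∀ u → Dec (v ≡ u) → labelsAt (v ∷ᵥ lab) u ≡ b u
    counts′ u (yes refl) = begin
      labelsAt (v ∷ᵥ lab) v ≡⟨ labelsAt-∷-self v lab ⟩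
      suc (labelsAt lab v)  ≡⟨ cong suc (trans (counts v) (decAt-self b v)) ⟩
      suc (b v ∸ 1)         ≡⟨ suc-∸1 (available⇒positive b v av) ⟩
      b v                   ∎
      where open ≡-Reasoning
    counts′ u (no v≢u) = trans (labelsAt-∷-other v lab u v≢u) (trans (counts u) (decAt-other b v u (v≢u ∘ sym)))
    increasing′ : ∀ i j → Ancestor (lookup (v ∷ᵥ lab) i) (lookup (v ∷ᵥ lab) j) → i < j
    increasing′ fzero    fzero    a = ⊥-elim (Ancestor-irrefl a)
    increasing′ fzero    (fsuc j) a = s≤s z≤n
    increasing′ (fsuc i) fzero    a =
      ⊥-elim (n≮0 (≤-trans labelled (≤-trans (decAt-≤ b v w) (≤-reflexive weightless))))
      where
        w = lookup lab i
        labelled : 1 ≤ decAt b v w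
        labelled = subst (1 ≤_) (counts w) (labelsAt-lookup lab i)
        weightless : b w ≡ 0
        weightless = available⇒ancestor-weightless b av a
    increasing′ (fsuc i) (fsuc j) a = s≤s (increasing i j a)

∈-allPos  : ∀ {t} (v : Pos t) → v ∈ allPos t
∈-allPosL : ∀ {ts} (v : PosL ts) → v ∈ allPosL ts
∈-allPos root = here refl
∈-allPos (below p) = there (∈-map⁺ below (∈-allPosL p))
∈-allPosL (hd p) = ∈-++⁺ˡ (∈-map⁺ hd (∈-allPos p))
∈-allPosL {t ∷ _} (tl p) = ∈-++⁺ʳ (map hd (allPos t)) (∈-map⁺ tl (∈-allPosL p))

allPos-unique  : ∀ t → Unique (allPos t)
allPosL-unique : ∀ ts → Unique (allPosL ts)
allPos-unique (node ts) = All.tabulate root∉ ∷ map⁺ below-inj (allPosL-unique ts)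
  where
    root∉ : ∀ {x} → x ∈ map below (allPosL ts) → root ≢ x
    root∉ x∈ with ∈-map⁻ below x∈
    ... | _ , _ , refl = λ ()
allPosL-unique [] = []
allPosL-unique (t ∷ ts) = ++⁺ (map⁺ hd-inj (allPos-unique t)) (map⁺ tl-inj (allPosL-unique ts)) disjoint
  where
    disjoint : ∀ {x} → ¬ (x ∈ map hd (allPos t) × x ∈ map tl (allPosL ts))
    disjoint (x∈hd , x∈tl) with ∈-map⁻ hd x∈hd | ∈-map⁻ tl x∈tl
    ... | _ , _ , refl | _ , _ , ()

labellings        : ∀ {t} m → (Pos t → ℕ) → List (Vec (Pos t) m)
labellingsFirstIn : ∀ {t} m → (Pos t → ℕ) → List (Pos t) → List (Vec (Pos t) (suc m))
labellingsFirstAt : ∀ {t} m → (Pos t → ℕ) → Pos t → List (Vec (Pos t) (suc m))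
labellings zero b = []ᵥ ∷ []
labellings {t} (suc m) b = labellingsFirstIn m b (allPos t)
labellingsFirstIn m b [] = []
labellingsFirstIn m b (v ∷ vs) = labellingsFirstAt m b v ++ labellingsFirstIn m b vs
labellingsFirstAt m b v = if available b v then map (v ∷ᵥ_) (labellings m (decAt b v)) else []

∈-labellingsFirstAt⁻ : ∀ {t m} (b : Pos t → ℕ) v {x} → x ∈ labellingsFirstAt m b v →
  available b v ≡ true × Σ (Vec (Pos t) m) (λ lab → lab ∈ labellings m (decAt b v) × x ≡ v ∷ᵥ lab)
∈-labellingsFirstAt⁻ b v x∈ with available b v
... | true = refl , ∈-map⁻ (v ∷ᵥ_) x∈

∈-labellingsFirstAt⁺ : ∀ {t m} (b : Pos t → ℕ) v {lab : Vec (Pos t) m} → available b v ≡ true →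
  lab ∈ labellings m (decAt b v) → v ∷ᵥ lab ∈ labellingsFirstAt m b v
∈-labellingsFirstAt⁺ b v av lab∈ with available b v
∈-labellingsFirstAt⁺ b v refl lab∈ | true = ∈-map⁺ (v ∷ᵥ_) lab∈

∈-labellingsFirstIn⁻ : ∀ {t m} (b : Pos t → ℕ) vs w (lab : Vec (Pos t) m) → w ∷ᵥ lab ∈ labellingsFirstIn m b vs →
  w ∈ vs × available b w ≡ true × lab ∈ labellings m (decAt b w)
∈-labellingsFirstIn⁻ b (v ∷ vs) w lab x∈ with ∈-++⁻ (labellingsFirstAt _ b v) x∈
... | inj₁ x∈v with ∈-labellingsFirstAt⁻ b v x∈v
...   | av , _ , lab∈ , refl = here refl , av , lab∈
∈-labellingsFirstIn⁻ b (v ∷ vs) w lab x∈ | inj₂ x∈vs =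
  let w∈ , av , lab∈ = ∈-labellingsFirstIn⁻ b vs w lab x∈vs in there w∈ , av , lab∈

∈-labellingsFirstIn⁺ : ∀ {t m} (b : Pos t → ℕ) vs w (lab : Vec (Pos t) m) → w ∈ vs → available b w ≡ true →
  lab ∈ labellings m (decAt b w) → w ∷ᵥ lab ∈ labellingsFirstIn m b vs
∈-labellingsFirstIn⁺ b (v ∷ vs) w lab (here refl) av lab∈ = ∈-++⁺ˡ (∈-labellingsFirstAt⁺ b w av lab∈)
∈-labellingsFirstIn⁺ b (v ∷ vs) w lab (there w∈) av lab∈ =
  ∈-++⁺ʳ (labellingsFirstAt _ b v) (∈-labellingsFirstIn⁺ b vs w lab w∈ av lab∈)

labellings-unique        : ∀ {t} m (b : Pos t → ℕ) → Unique (labellings m b)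
labellingsFirstIn-unique : ∀ {t} m (b : Pos t → ℕ) vs → Unique vs → Unique (labellingsFirstIn m b vs)
labellingsFirstAt-unique : ∀ {t} m (b : Pos t → ℕ) v → Unique (labellingsFirstAt m b v)
labellings-unique zero b = [] ∷ []
labellings-unique {t} (suc m) b = labellingsFirstIn-unique m b (allPos t) (allPos-unique t)
labellingsFirstIn-unique m b [] _ = []
labellingsFirstIn-unique m b (v ∷ vs) (v∉vs ∷ vs-unique) =
  ++⁺ (labellingsFirstAt-unique m b v) (labellingsFirstIn-unique m b vs vs-unique) disjoint
  where
    disjoint : ∀ {x} → ¬ (x ∈ labellingsFirstAt m b v × x ∈ labellingsFirstIn m b vs)
    disjoint (x∈v , x∈vs) with ∈-labellingsFirstAt⁻ b v x∈v
    ... | _ , lab , _ , refl = All.lookup v∉vs (proj₁ (∈-labellingsFirstIn⁻ b vs v lab x∈vs)) refl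
labellingsFirstAt-unique m b v with available b v
... | true  = map⁺ ∷-injectiveʳ (labellings-unique m (decAt b v))
... | false = []

sumPos-decAt-available : ∀ {t m} (b : Pos t → ℕ) v → available b v ≡ true → sumPos b ≡ suc m → sumPos (decAt b v) ≡ m
sumPos-decAt-available b v av Σb≡1+m = suc-injective (trans (sym (sumPos-decAt b v (available⇒positive b v av))) Σb≡1+m)

sum≡0⇒All≡0 : ∀ {A : Set} (f : A → ℕ) xs → sum (map f xs) ≡ 0 → All (λ x → f x ≡ 0) xs
sum≡0⇒All≡0 f [] _ = []
sum≡0⇒All≡0 f (x ∷ xs) Σ≡0 = m+n≡0⇒m≡0 (f x) Σ≡0 ∷ sum≡0⇒All≡0 f xs (m+n≡0⇒n≡0 (f x) Σ≡0)

product≡1 : ∀ {A : Set} (f : A → ℕ) {xs} → All (λ x → f x ≡ 1) xs → product (map f xs) ≡ 1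
product≡1 f [] = refl
product≡1 f (fx≡1 ∷ fxs≡1) = cong₂ _*_ fx≡1 (product≡1 f fxs≡1)

labellings-sound : ∀ {t} m (b : Pos t → ℕ) → sumPos b ≡ m →
  ∀ lab → lab ∈ labellings m b → IsAncIncMultilabelling b lab
labellings-sound {t} zero b Σb≡0 []ᵥ _ =
  (λ v → sym (All.lookup (sum≡0⇒All≡0 b (allPos t) Σb≡0) (∈-allPos v))) , λ ()
labellings-sound (suc m) b Σb≡1+m (w ∷ᵥ lab) w∷lab∈ =
  let _ , av , lab∈ = ∈-labellingsFirstIn⁻ b (allPos _) w lab w∷lab∈
  in isAncInc-∷⁺ b w lab av (labellings-sound m (decAt b w) (sumPos-decAt-available b w av Σb≡1+m) lab lab∈)

labellings-complete : ∀ {t} m (b : Pos t → ℕ) → sumPos b ≡ m →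
  ∀ lab → IsAncIncMultilabelling b lab → lab ∈ labellings m b
labellings-complete zero b _ []ᵥ _ = here refl
labellings-complete (suc m) b Σb≡1+m (w ∷ᵥ lab) inc =
  let av , inc′ = isAncInc-∷⁻ b w lab inc
  in ∈-labellingsFirstIn⁺ b (allPos _) w lab (∈-allPos w) av
       (labellings-complete m (decAt b w) (sumPos-decAt-available b w av Σb≡1+m) lab inc′)

length-labellings        : ∀ {t} m (b : Pos t → ℕ) → sumPos b ≡ m →
  length (labellings m b) * prodPos (fallingHook b) ≡ m !
length-labellingsFirstIn : ∀ {t} m (b : Pos t → ℕ) → sumPos b ≡ suc m → ∀ vs →
  length (labellingsFirstIn m b vs) * prodPos (fallingHook b) ≡ m ! * sum (map (availableHook b) vs)
length-labellingsFirstAt : ∀ {t} m (b : Pos t → ℕ) → sumPos b ≡ suc m → ∀ v →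
  length (labellingsFirstAt m b v) * prodPos (fallingHook b) ≡ m ! * availableHook b v
length-labellings {t} zero b Σb≡0 = trans (+-identityʳ _)
  (product≡1 (fallingHook b) (All.map (λ {v} → cong (hook b v ↓_)) (sum≡0⇒All≡0 b (allPos t) Σb≡0)))
length-labellings {t} (suc m) b Σb≡1+m = begin
  length (labellingsFirstIn m b (allPos t)) * prodPos (fallingHook b) ≡⟨ length-labellingsFirstIn m b Σb≡1+m (allPos t) ⟩
  m ! * sumPos (availableHook b)                                      ≡⟨ cong (m ! *_) (trans (sumPos-availableHook b) Σb≡1+m) ⟩
  m ! * suc m                                                         ≡⟨ *-comm (m !) (suc m) ⟩
  suc m !                                                             ∎
  where open ≡-Reasoning
length-labellingsFirstIn m b _ [] = sym (*-zeroʳ (m !))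
length-labellingsFirstIn m b Σb≡1+m (v ∷ vs) = begin
  length (labellingsFirstAt m b v ++ labellingsFirstIn m b vs) * P       ≡⟨ cong (_* P) (length-++ (labellingsFirstAt m b v)) ⟩
  (length (labellingsFirstAt m b v) + length (labellingsFirstIn m b vs)) * P ≡⟨ *-distribʳ-+ P (length (labellingsFirstAt m b v)) _ ⟩
  length (labellingsFirstAt m b v) * P + length (labellingsFirstIn m b vs) * P
    ≡⟨ cong₂ _+_ (length-labellingsFirstAt m b Σb≡1+m v) (length-labellingsFirstIn m b Σb≡1+m vs) ⟩
  m ! * availableHook b v + m ! * sum (map (availableHook b) vs)        ≡⟨ sym (*-distribˡ-+ (m !) (availableHook b v) _) ⟩
  m ! * sum (map (availableHook b) (v ∷ vs))                            ∎
  where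
    open ≡-Reasoning
    P = prodPos (fallingHook b)
length-labellingsFirstAt m b Σb≡1+m v with available b v in av
... | false = sym (*-zeroʳ (m !))
... | true = begin
  length (map (v ∷ᵥ_) L) * prodPos (fallingHook b) ≡⟨ cong₂ _*_ (length-map (v ∷ᵥ_) L) (prodPos-decAt b v av) ⟩
  length L * (hook b v * prodPos (fallingHook (decAt b v))) ≡⟨ x∙yz≈y∙xz (length L) (hook b v) _ ⟩
  hook b v * (length L * prodPos (fallingHook (decAt b v))) ≡⟨ cong (hook b v *_) (length-labellings m (decAt b v) (sumPos-decAt-available b v av Σb≡1+m)) ⟩
  hook b v * m !                                            ≡⟨ *-comm (hook b v) (m !) ⟩
  m ! * hook b v                                            ∎
  where
    open ≡-Reasoning
    L = labellings m (decAt b v)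

isAncInc⇒isInc : ∀ {t m} (b : Pos t → ℕ) (lab : Vec (Pos t) m) → IsAncIncMultilabelling b lab → IsIncMultilabelling b lab
isAncInc⇒isInc b lab (counts , increasing) = counts , λ i j p → increasing i j (Par⇒Ancestor p)

-- When every node carries a label, the parent–child inequalities chain along paths.
isInc⇒isAncInc : ∀ {t m} (b : Pos t → ℕ) → (∀ v → 1 ≤ b v) → (lab : Vec (Pos t) m) →
  IsIncMultilabelling b lab → IsAncIncMultilabelling b lab
isInc⇒isAncInc b positive lab (counts , increasing) = counts , λ i j a → along (Ancestor⇒Par⁺ a) i j refl refl
  where
    along : ∀ {u w} → Plus Par u w → ∀ i j → lookup lab i ≡ u → lookup lab j ≡ w → i < j
    along [ p ] i j refl refl = increasing i j p
    along (_∼⁺⟨_⟩_ _ {y} p q) i j i↦u j↦w with labelsAt-positive⇒lookup lab y (subst (1 ≤_) (sym (counts y)) (positive y))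
    ... | k , k↦y = Fin.<-trans (along p i k i↦u k↦y) (along q k j k↦y j↦w)

lemma7p9 : (t : Tree) (b : Pos t → ℕ) → (∀ v → 1 ≤ b v) →
    (m : ℕ) → sum (map b (allPos t)) ≡ m →
    Σ (List (Vec (Pos t) m)) (λ L →
    Unique L ×
    (∀ lab → (lab ∈ L) ⇔ IsIncMultilabelling b lab) ×
    length L * product (map (λ v → hook b v ↓ b v) (allPos t)) ≡ m !)
lemma7p9 t b positive m Σb≡m =
  labellings m b ,
  labellings-unique m b ,
  (λ lab → mk⇔ (isAncInc⇒isInc b lab ∘ labellings-sound m b Σb≡m lab)
               (labellings-complete m b Σb≡m lab ∘ isInc⇒isAncInc b positive lab)) ,
  length-labellings m b Σb≡m
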